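{- For all $n\geq 1$, if $G$ maximizes $P$ over $D(n)$, then $G$ contains no $(3,1,1)$-triangle and no $(2,1,1)$-triangle.
   Context: A multigraph is $(V,w)$ with $w:\binom V2\to\mathbb{N}$; $\mu(G)=\max w$, $P(G)=\prod w$. An $(s,q)$-graph is one in which every $s$ vertices span total multiplicity at most $q$; $F(n,s,q)$ is the set of $(s,q)$-graphs on $[n]$. $D(n)=\{G\in F(n,4,15):\mu(G)\le 3\}\cap F(n,3,8)$. An $(i,j,k)$-triangle in $G$ is a 3-set $\{x,y,z\}$ of vertices whose multiset of multiplicities $\{w(xy),w(yz),w(xz)\}$ equals $\{i,j,k\}$. -}

module Defs where

open import Data.Nat using (ℕ; _+_; _≤_)
open import Data.Fin using (Fin; _<_; _<?_)
open import Data.Nat.ListAction using (product)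
open import Data.List using (List; map; filter; concatMap; allFin)
open import Data.Product using (_×_; _,_; uncurry)
open import Relation.Binary.PropositionalEquality using (_≡_; _≢_)

-- Only the values w x y with x ≢ y are meaningful (the diagonal is ignored
-- by every notion below), so this represents w : (Fin n choose 2) → ℕ.
record Multigraph (n : ℕ) : Set where
  field
    w    : Fin n → Fin n → ℕ
    sym  : ∀ x y → w x y ≡ w y x
open Multigraph public

pairs : (n : ℕ) → List (Fin n × Fin n)
pairs n = filter (λ p → uncurry _<?_ p)
                 (concatMap (λ i → map (λ j → (i , j)) (allFin n)) (allFin n))

P : ∀ {n} → Multigraph n → ℕ
P {n} G = product (map (λ p → w G (Data.Product.proj₁ p) (Data.Product.proj₂ p)) (pairs n))

MaxMultAtMost : ∀ {n} → ℕ → Multigraph n → Set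
MaxMultAtMost m G = ∀ x y → x ≢ y → w G x y ≤ m

Is3Graph : ∀ {n} → ℕ → Multigraph n → Set
Is3Graph q G = ∀ x y z → x ≢ y → x ≢ z → y ≢ z →
  w G x y + w G y z + w G x z ≤ q

Is4Graph : ∀ {n} → ℕ → Multigraph n → Set
Is4Graph q G = ∀ a b c d → a ≢ b → a ≢ c → a ≢ d → b ≢ c → b ≢ d → c ≢ d →
  w G a b + w G a c + w G a d + w G b c + w G b d + w G c d ≤ q

InD : ∀ {n} → Multigraph n → Set
InD G = Is4Graph 15 G × MaxMultAtMost 3 G × Is3Graph 8 G

MaximizesP : ∀ {n} → Multigraph n → Set
MaximizesP {n} G = InD G × (∀ (H : Multigraph n) → InD H → P H ≤ P G)

-- G contains an (i,j,k)-triangle: distinct x,y,z whose three multiplicities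
-- form the multiset {i,j,k} (all orderings are covered by quantifying over
-- ordered triples of distinct vertices and a fixed assignment i,j,k)
HasTriangle : ∀ {n} → ℕ → ℕ → ℕ → Multigraph n → Set
HasTriangle {n} i j k G = Data.Product.Σ (Fin n) λ x → Data.Product.Σ (Fin n) λ y →
  Data.Product.Σ (Fin n) λ z →
  (x ≢ y) × (x ≢ z) × (y ≢ z) × (w G x y ≡ i) × (w G y z ≡ j) × (w G x z ≡ k)

-- Write P_v(G) for the product of the multiplicities of the edges at v. If G and H
-- differ only in edges through v, then P(H) P_v(G) = P(G) P_v(H). Turning v into a
-- twin of a vertex s with w(sv) = 1, the new pair {v, s} again of multiplicity 1,
-- stays inside D(n); so in a maximizer P_s ≤ P_v whenever w(sv) = 1. For a triangle
-- xyz with w(xy) = a ≥ 2 and w(yz) = w(xz) = 1 this gives P_x, P_y ≤ P_z, and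
-- cloning z onto y and then onto x multiplies P by a P_z² / (P_x P_y) ≥ 2.
-- Quotients are kept cross-multiplied; P_z ≠ 0 since P(G) = P(G with z isolated) P_z.

module Submission where

open import Defs hiding (sym)
open import Data.Bool using (true; false; if_then_else_; _∨_)
open import Data.Bool.Properties using (if-cong; if-cong-else; if-eta; ∨-comm)
open import Data.Fin using (Fin; zero; suc; _<_; _<?_)
open import Data.Fin.Properties using (_≟_; <-cmp; <-irrefl; <-asym; <⇒≢; punchInᵢ≢i)
open import Data.List using (List; []; _∷_; map; filter; concatMap; allFin; tabulate; _++_)
open import Data.List.Properties using (map-++; map-tabulate; map-cong; map-∘)
open import Data.Nat using (ℕ; zero; suc; z≤n; s≤s; _+_; _*_; _≤_; _≥_; NonZero; >-nonZero)
open import Data.Nat.ListAction using (product)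
open import Data.Nat.ListAction.Properties using (product-++)
open import Data.Nat.Properties
  using (*-1-commutativeMonoid; *-commutativeSemigroup; *-assoc; *-identityˡ; *-identityʳ;
         *-mono-≤; *-monoˡ-≤; *-cancelˡ-≤; +-mono-≤; ≤-refl; ≤-reflexive; ≤-trans;
         m<m*n; m*n≢0; m*n≢0⇒n≢0; <⇒≱; n≤1+n; m≤m+n; module ≤-Reasoning)
open import Data.Nat.Solver using (module +-*-Solver)
open import Algebra.Properties.CommutativeSemigroup *-commutativeSemigroup
  using (xy∙z≈xz∙y; xy∙z≈zy∙x)
open import Data.Product using (_×_; _,_; uncurry)
open import Data.Vec.Functional using (removeAt)
open import Function using (_∘_; id)
open import Relation.Binary.Definitions using (tri<; tri≈; tri>)
open import Relation.Binary.PropositionalEquality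
open import Relation.Nullary using (¬_; Dec; yes; no; does)
open import Relation.Nullary.Decidable using (dec-true; dec-false)

open import Algebra.Properties.CommutativeMonoid.Sum *-1-commutativeMonoid
  using ()
  renaming (sum to ∏; sum-cong-≗ to ∏-cong; ∑-distrib-+ to ∏-distrib-*;
            sum-remove to ∏-remove; sum-replicate-zero to ∏-replicate-1)

private variable
  n : ℕ

-- Products over Fin n

∏-except : (f g : Fin n → ℕ) (v : Fin n) → (∀ i → i ≢ v → f i ≡ g i) →
  ∏ f * g v ≡ ∏ g * f v
∏-except {suc n} f g v f≡g = begin
  ∏ f * g v                       ≡⟨ cong (_* g v) (∏-remove {i = v} f) ⟩
  f v * ∏ (removeAt f v) * g v    ≡⟨ cong (λ r → f v * r * g v) (∏-cong (λ j → f≡g _ (punchInᵢ≢i v j))) ⟩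
  f v * ∏ (removeAt g v) * g v    ≡⟨ xy∙z≈zy∙x (f v) _ (g v) ⟩
  g v * ∏ (removeAt g v) * f v    ≡⟨ cong (_* f v) (∏-remove {i = v} g) ⟨
  ∏ g * f v                       ∎
  where open ≡-Reasoning

product-map-filter : ∀ {A : Set} {Q : A → Set} (Q? : ∀ a → Dec (Q a)) (f : A → ℕ) xs →
  product (map f (filter Q? xs)) ≡ product (map (λ a → if does (Q? a) then f a else 1) xs)
product-map-filter Q? f [] = refl
product-map-filter Q? f (x ∷ xs) with does (Q? x)
... | true  = cong (f x *_) (product-map-filter Q? f xs)
... | false = trans (product-map-filter Q? f xs) (sym (*-identityˡ _))

product-map-concatMap : ∀ {A B : Set} (f : B → ℕ) (k : A → List B) xs →
  product (map f (concatMap k xs)) ≡ product (map (λ a → product (map f (k a))) xs)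
product-map-concatMap f k [] = refl
product-map-concatMap f k (x ∷ xs) = begin
  product (map f (k x ++ concatMap k xs))                ≡⟨ cong product (map-++ f (k x) _) ⟩
  product (map f (k x) ++ map f (concatMap k xs))        ≡⟨ product-++ (map f (k x)) _ ⟩
  product (map f (k x)) * product (map f (concatMap k xs)) ≡⟨ cong (product (map f (k x)) *_) (product-map-concatMap f k xs) ⟩
  product (map (λ a → product (map f (k a))) (x ∷ xs))   ∎
  where open ≡-Reasoning

product-tabulate : (f : Fin n → ℕ) → product (tabulate f) ≡ ∏ f
product-tabulate {zero}  f = refl
product-tabulate {suc n} f = cong (f zero *_) (product-tabulate (f ∘ suc))

product-map-allFin : (f : Fin n → ℕ) → product (map f (allFin n)) ≡ ∏ f
product-map-allFin {n} f = trans (cong product (map-tabulate id f)) (product-tabulate f)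

-- P as a product of rows, and its dependence on a single vertex

upper : Multigraph n → Fin n → Fin n → ℕ
upper G i j = if does (i <? j) then w G i j else 1

row : Multigraph n → Fin n → ℕ
row G i = ∏ (upper G i)

column : Multigraph n → Fin n → ℕ
column G j = ∏ (λ i → upper G i j)

P≡∏row : (G : Multigraph n) → P G ≡ ∏ (row G)
P≡∏row {n} G = begin
  P G                                                  ≡⟨ product-map-filter (uncurry _<?_) weight pairsFrom ⟩
  product (map (uncurry (upper G)) pairsFrom)          ≡⟨ product-map-concatMap _ rowPairs (allFin n) ⟩
  product (map (λ i → product (map (uncurry (upper G)) (rowPairs i))) (allFin n))
                                                       ≡⟨ cong product (map-cong rowProduct (allFin n)) ⟩
  product (map (row G) (allFin n))                     ≡⟨ product-map-allFin (row G) ⟩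
  ∏ (row G)                                            ∎
  where
  open ≡-Reasoning
  weight : Fin n × Fin n → ℕ
  weight (i , j) = w G i j
  rowPairs : Fin n → List (Fin n × Fin n)
  rowPairs i = map (i ,_) (allFin n)
  pairsFrom : List (Fin n × Fin n)
  pairsFrom = concatMap rowPairs (allFin n)
  rowProduct : ∀ i → product (map (uncurry (upper G)) (rowPairs i)) ≡ row G i
  rowProduct i = trans (cong product (sym (map-∘ (allFin n)))) (product-map-allFin (upper G i))

upper-< : (G : Multigraph n) {i j : Fin n} → i < j → upper G i j ≡ w G i j
upper-< G {i} {j} i<j = if-cong (dec-true (i <? j) i<j)

upper-≮ : (G : Multigraph n) {i j : Fin n} → ¬ i < j → upper G i j ≡ 1
upper-≮ G {i} {j} i≮j = if-cong (dec-false (i <? j) i≮j)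

-- The diagonal value w G v v carries no meaning, hence the factor 1 at t = v.
incident : Multigraph n → Fin n → Fin n → ℕ
incident G v t = if does (t ≟ v) then 1 else w G v t

vertexProduct : Multigraph n → Fin n → ℕ
vertexProduct G v = ∏ (incident G v)

incident-self : (G : Multigraph n) (v : Fin n) → incident G v v ≡ 1
incident-self G v = if-cong (dec-true (v ≟ v) refl)

incident-other : (G : Multigraph n) {v t : Fin n} → t ≢ v → incident G v t ≡ w G v t
incident-other G {v} {t} t≢v = if-cong (dec-false (t ≟ v) t≢v)

vertexProduct≡column*row : (G : Multigraph n) (v : Fin n) →
  vertexProduct G v ≡ column G v * row G v
vertexProduct≡column*row G v = trans (∏-cong factor) (∏-distrib-* (λ t → upper G t v) (upper G v))
  where
  factor : ∀ t → incident G v t ≡ upper G t v * upper G v t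
  factor t with <-cmp t v
  ... | tri< t<v _ _ = begin
    incident G v t               ≡⟨ incident-other G (<⇒≢ t<v) ⟩
    w G v t                      ≡⟨ Multigraph.sym G v t ⟩
    w G t v                      ≡⟨ *-identityʳ _ ⟨
    w G t v * 1                  ≡⟨ cong₂ _*_ (upper-< G t<v) (upper-≮ G (<-asym t<v)) ⟨
    upper G t v * upper G v t    ∎
    where open ≡-Reasoning
  ... | tri≈ _ refl _ =
    trans (incident-self G t) (sym (cong₂ _*_ (upper-≮ G {t} (<-irrefl refl)) (upper-≮ G {t} (<-irrefl refl))))
  ... | tri> _ _ v<t = begin
    incident G v t               ≡⟨ incident-other G (<⇒≢ v<t ∘ sym) ⟩
    w G v t                      ≡⟨ *-identityˡ _ ⟨
    1 * w G v t                  ≡⟨ cong₂ _*_ (upper-≮ G (<-asym v<t)) (upper-< G v<t) ⟨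
    upper G t v * upper G v t    ∎
    where open ≡-Reasoning

AgreeOff : Fin n → Multigraph n → Multigraph n → Set
AgreeOff v G H = ∀ i j → i ≢ j → i ≢ v → j ≢ v → w G i j ≡ w H i j

mixedRow : Multigraph n → Multigraph n → Fin n → Fin n → ℕ
mixedRow G H v i = row G i * upper H i v

∏mixedRow : (G H : Multigraph n) (v : Fin n) →
  ∏ (mixedRow G H v) * mixedRow H G v v ≡ P G * vertexProduct H v
∏mixedRow G H v = begin
  ∏ (mixedRow G H v) * (row H v * upper G v v) ≡⟨ cong₂ _*_ (∏-distrib-* (row G) _) rowH ⟩
  ∏ (row G) * column H v * row H v            ≡⟨ *-assoc (∏ (row G)) (column H v) (row H v) ⟩
  ∏ (row G) * (column H v * row H v)          ≡⟨ cong₂ _*_ (P≡∏row G) (vertexProduct≡column*row H v) ⟨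
  P G * vertexProduct H v                     ∎
  where
  open ≡-Reasoning
  rowH : row H v * upper G v v ≡ row H v
  rowH = trans (cong (row H v *_) (upper-≮ G {v} (<-irrefl refl))) (*-identityʳ _)

P-local : (G H : Multigraph n) (v : Fin n) → AgreeOff v G H →
  P H * vertexProduct G v ≡ P G * vertexProduct H v
P-local G H v agree = begin
  P H * vertexProduct G v                ≡⟨ ∏mixedRow H G v ⟨
  ∏ (mixedRow H G v) * mixedRow G H v v  ≡⟨ ∏-except _ _ v mixedRow-agree ⟩
  ∏ (mixedRow G H v) * mixedRow H G v v  ≡⟨ ∏mixedRow G H v ⟩
  P G * vertexProduct H v                ∎
  where
  open ≡-Reasoning
  upper-agree : ∀ {i j} → i ≢ v → j ≢ v → upper H i j ≡ upper G i j
  upper-agree {i} {j} i≢v j≢v with i <? j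
  ... | yes i<j = trans (upper-< H i<j) (trans (sym (agree i j (<⇒≢ i<j) i≢v j≢v)) (sym (upper-< G i<j)))
  ... | no i≮j  = trans (upper-≮ H i≮j) (sym (upper-≮ G i≮j))
  mixedRow-agree : ∀ i → i ≢ v → mixedRow H G v i ≡ mixedRow G H v i
  mixedRow-agree i i≢v = ∏-except (upper H i) (upper G i) v (λ j j≢v → upper-agree i≢v j≢v)

-- Cloning a vertex

spanned₃ : Multigraph n → Fin n → Fin n → Fin n → ℕ
spanned₃ G a b c = w G a b + w G b c + w G a c

spanned₄ : Multigraph n → Fin n → Fin n → Fin n → Fin n → ℕ
spanned₄ G a b c d = w G a b + w G a c + w G a d + w G b c + w G b d + w G c d

spanned₃-≤ : (G : Multigraph n) (a b c : Fin n) {p q r : ℕ} →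
  w G a b ≤ p → w G b c ≤ q → w G a c ≤ r → spanned₃ G a b c ≤ p + q + r
spanned₃-≤ G a b c ab bc ac = +-mono-≤ (+-mono-≤ ab bc) ac

spanned₄-≤ : (G : Multigraph n) (a b c d : Fin n) {p q r t k : ℕ} →
  spanned₃ G a b c ≤ p → spanned₃ G a b d ≤ q → spanned₃ G a c d ≤ r → spanned₃ G b c d ≤ t →
  p + q + r + t ≤ 2 * k → spanned₄ G a b c d ≤ k
spanned₄-≤ G a b c d {p} {q} {r} {t} {k} abc abd acd bcd p+q+r+t≤2k = *-cancelˡ-≤ 2 (begin
  2 * spanned₄ G a b c d                                                      ≡⟨ each-pair-in-two-triples ⟩
  spanned₃ G a b c + spanned₃ G a b d + spanned₃ G a c d + spanned₃ G b c d  ≤⟨ +-mono-≤ (+-mono-≤ (+-mono-≤ abc abd) acd) bcd ⟩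
  p + q + r + t                                                               ≤⟨ p+q+r+t≤2k ⟩
  2 * k                                                                       ∎)
  where
  open ≤-Reasoning
  open +-*-Solver
  each-pair-in-two-triples :
    2 * spanned₄ G a b c d ≡ spanned₃ G a b c + spanned₃ G a b d + spanned₃ G a c d + spanned₃ G b c d
  each-pair-in-two-triples = solve 6 (λ ab ac ad bc bd cd →
    con 2 :* (ab :+ ac :+ ad :+ bc :+ bd :+ cd) :=
    (ab :+ bc :+ ac) :+ (ab :+ bd :+ ad) :+ (ac :+ cd :+ ad) :+ (bc :+ cd :+ bd))
    refl (w G a b) (w G a c) (w G a d) (w G b c) (w G b d) (w G c d)

redirect : Fin n → Fin n → Fin n → Fin n
redirect v s i = if does (i ≟ v) then s else i

redirect-self : (v s : Fin n) → redirect v s v ≡ s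
redirect-self v s = if-cong (dec-true (v ≟ v) refl)

redirect-other : {v i : Fin n} (s : Fin n) → i ≢ v → redirect v s i ≡ i
redirect-other {v = v} {i} s i≢v = if-cong (dec-false (i ≟ v) i≢v)

module _ (G : Multigraph n) (v s : Fin n) where
  private
    ρ : Fin n → Fin n
    ρ = redirect v s

    ρv≡s : ρ v ≡ s
    ρv≡s = redirect-self v s

    ρ-other : ∀ {i} → i ≢ v → ρ i ≡ i
    ρ-other = redirect-other s

  -- Vertex v becomes a twin of s: the pairs whose ends are redirected to one
  -- vertex are the diagonal and {v, s}, and {v, s} gets multiplicity 1.
  cloneWeight : Fin n → Fin n → ℕ
  cloneWeight i j = if does (ρ i ≟ ρ j) then 1 else w G (ρ i) (ρ j)

  cloneWeight-joined : ∀ i j → ρ i ≡ ρ j → cloneWeight i j ≡ 1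
  cloneWeight-joined i j e = if-cong (dec-true (ρ i ≟ ρ j) e)

  cloneWeight-apart : ∀ i j → ρ i ≢ ρ j → cloneWeight i j ≡ w G (ρ i) (ρ j)
  cloneWeight-apart i j ne = if-cong (dec-false (ρ i ≟ ρ j) ne)

  clone : Multigraph n
  clone = record { w = cloneWeight ; sym = cloneWeight-sym }
    where
    cloneWeight-sym : ∀ i j → cloneWeight i j ≡ cloneWeight j i
    cloneWeight-sym i j = by-cases (ρ i ≟ ρ j)
      where
      by-cases : Dec (ρ i ≡ ρ j) → cloneWeight i j ≡ cloneWeight j i
      by-cases (yes e) = trans (cloneWeight-joined i j e) (sym (cloneWeight-joined j i (sym e)))
      by-cases (no ne) = trans (cloneWeight-apart i j ne)
        (trans (Multigraph.sym G _ _) (sym (cloneWeight-apart j i (ne ∘ sym))))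

  clone-agreeOff : AgreeOff v G clone
  clone-agreeOff i j i≢j i≢v j≢v = sym (begin
    cloneWeight i j    ≡⟨ cloneWeight-apart i j ρi≢ρj ⟩
    w G (ρ i) (ρ j)    ≡⟨ cong₂ (w G) (ρ-other i≢v) (ρ-other j≢v) ⟩
    w G i j            ∎)
    where
    open ≡-Reasoning
    ρi≢ρj : ρ i ≢ ρ j
    ρi≢ρj e = i≢j (trans (sym (ρ-other i≢v)) (trans e (ρ-other j≢v)))

  clone-edge : s ≢ v → w clone v s ≡ 1
  clone-edge s≢v = cloneWeight-joined v s (trans ρv≡s (sym (ρ-other s≢v)))

  clone-twin : ∀ {t} → t ≢ v → t ≢ s → w clone v t ≡ w G s t
  clone-twin {t} t≢v t≢s = trans (cloneWeight-apart v t ρv≢ρt) (cong₂ (w G) ρv≡s (ρ-other t≢v))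
    where
    ρv≢ρt : ρ v ≢ ρ t
    ρv≢ρt e = t≢s (trans (sym (ρ-other t≢v)) (trans (sym e) ρv≡s))

  clone-simple : ∀ i j → ρ i ≡ ρ j → w clone i j ≤ 1
  clone-simple i j e = ≤-reflexive (cloneWeight-joined i j e)

  clone-≤3 : MaxMultAtMost 3 G → ∀ i j → w clone i j ≤ 3
  clone-≤3 μ≤3 i j = by-cases (ρ i ≟ ρ j)
    where
    by-cases : Dec (ρ i ≡ ρ j) → cloneWeight i j ≤ 3
    by-cases (yes e) = ≤-trans (clone-simple i j e) (s≤s z≤n)
    by-cases (no ne) = ≤-trans (≤-reflexive (cloneWeight-apart i j ne)) (μ≤3 _ _ ne)

  clone-spanned₃≤8 : MaxMultAtMost 3 G → Is3Graph 8 G → ∀ a b c → spanned₃ clone a b c ≤ 8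
  clone-spanned₃≤8 μ≤3 is3 a b c = by-cases (ρ a ≟ ρ b) (ρ b ≟ ρ c) (ρ a ≟ ρ c)
    where
    μ : ∀ i j → w clone i j ≤ 3
    μ = clone-≤3 μ≤3
    by-cases : Dec (ρ a ≡ ρ b) → Dec (ρ b ≡ ρ c) → Dec (ρ a ≡ ρ c) → spanned₃ clone a b c ≤ 8
    by-cases (no ab) (no bc) (no ac) = subst (_≤ 8) (sym (cong₂ _+_
      (cong₂ _+_ (cloneWeight-apart a b ab) (cloneWeight-apart b c bc)) (cloneWeight-apart a c ac)))
      (is3 _ _ _ ab ac bc)
    by-cases (yes ab) _        _        =
      ≤-trans (spanned₃-≤ clone a b c (clone-simple a b ab) (μ b c) (μ a c)) (n≤1+n 7)
    by-cases (no _)   (yes bc) _        =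
      ≤-trans (spanned₃-≤ clone a b c (μ a b) (clone-simple b c bc) (μ a c)) (n≤1+n 7)
    by-cases (no _)   (no _)   (yes ac) =
      ≤-trans (spanned₃-≤ clone a b c (μ a b) (μ b c) (clone-simple a c ac)) (n≤1+n 7)

  clone-spanned₄≤15 : InD G → ∀ a b c d → spanned₄ clone a b c d ≤ 15
  clone-spanned₄≤15 (is4 , μ≤3 , is3) a b c d =
    by-cases (ρ a ≟ ρ b) (ρ a ≟ ρ c) (ρ a ≟ ρ d) (ρ b ≟ ρ c) (ρ b ≟ ρ d) (ρ c ≟ ρ d)
    where
    μ : ∀ i j → w clone i j ≤ 3
    μ = clone-≤3 μ≤3
    Δ : ∀ x y z → spanned₃ clone x y z ≤ 8
    Δ = clone-spanned₃≤8 μ≤3 is3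
    -- A joined pair, i.e. {v, s}, lies in two of the four triples, which then weigh at
    -- most 1 + 3 + 3; and 7 + 7 + 8 + 8 = 2 · 15.
    by-cases : Dec (ρ a ≡ ρ b) → Dec (ρ a ≡ ρ c) → Dec (ρ a ≡ ρ d) →
               Dec (ρ b ≡ ρ c) → Dec (ρ b ≡ ρ d) → Dec (ρ c ≡ ρ d) → spanned₄ clone a b c d ≤ 15
    by-cases (no ab) (no ac) (no ad) (no bc) (no bd) (no cd) =
      subst (_≤ 15) (sym all-apart) (is4 _ _ _ _ ab ac ad bc bd cd)
      where
      all-apart : spanned₄ clone a b c d ≡ spanned₄ G (ρ a) (ρ b) (ρ c) (ρ d)
      all-apart = cong₂ _+_ (cong₂ _+_ (cong₂ _+_ (cong₂ _+_ (cong₂ _+_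
        (cloneWeight-apart a b ab) (cloneWeight-apart a c ac)) (cloneWeight-apart a d ad))
        (cloneWeight-apart b c bc)) (cloneWeight-apart b d bd)) (cloneWeight-apart c d cd)
    by-cases (yes ab) _ _ _ _ _ = spanned₄-≤ clone a b c d
      (spanned₃-≤ clone a b c (clone-simple a b ab) (μ b c) (μ a c))
      (spanned₃-≤ clone a b d (clone-simple a b ab) (μ b d) (μ a d))
      (Δ a c d) (Δ b c d) ≤-refl
    by-cases (no _) (yes ac) _ _ _ _ = spanned₄-≤ clone a b c d
      (spanned₃-≤ clone a b c (μ a b) (μ b c) (clone-simple a c ac))
      (Δ a b d)
      (spanned₃-≤ clone a c d (clone-simple a c ac) (μ c d) (μ a d))
      (Δ b c d) ≤-refl
    by-cases (no _) (no _) (yes ad) _ _ _ = spanned₄-≤ clone a b c d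
      (Δ a b c)
      (spanned₃-≤ clone a b d (μ a b) (μ b d) (clone-simple a d ad))
      (spanned₃-≤ clone a c d (μ a c) (μ c d) (clone-simple a d ad))
      (Δ b c d) ≤-refl
    by-cases (no _) (no _) (no _) (yes bc) _ _ = spanned₄-≤ clone a b c d
      (spanned₃-≤ clone a b c (μ a b) (clone-simple b c bc) (μ a c))
      (Δ a b d) (Δ a c d)
      (spanned₃-≤ clone b c d (clone-simple b c bc) (μ c d) (μ b d)) ≤-refl
    by-cases (no _) (no _) (no _) (no _) (yes bd) _ = spanned₄-≤ clone a b c d
      (Δ a b c)
      (spanned₃-≤ clone a b d (μ a b) (clone-simple b d bd) (μ a d))
      (Δ a c d)
      (spanned₃-≤ clone b c d (μ b c) (μ c d) (clone-simple b d bd)) ≤-refl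
    by-cases (no _) (no _) (no _) (no _) (no _) (yes cd) = spanned₄-≤ clone a b c d
      (Δ a b c) (Δ a b d)
      (spanned₃-≤ clone a c d (μ a c) (clone-simple c d cd) (μ a d))
      (spanned₃-≤ clone b c d (μ b c) (clone-simple c d cd) (μ b d)) ≤-refl

  clone-InD : InD G → InD clone
  clone-InD inD@(_ , μ≤3 , is3) =
    (λ a b c d _ _ _ _ _ _ → clone-spanned₄≤15 inD a b c d) ,
    (λ i j _ → clone-≤3 μ≤3 i j) ,
    (λ a b c _ _ _ → clone-spanned₃≤8 μ≤3 is3 a b c)

  vertexProduct-clone-self : v ≢ s → w G s v ≡ 1 → vertexProduct clone v ≡ vertexProduct G s
  vertexProduct-clone-self v≢s sv≡1 = ∏-cong (λ t → factor t (t ≟ v) (t ≟ s))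
    where
    factor : ∀ t → Dec (t ≡ v) → Dec (t ≡ s) → incident clone v t ≡ incident G s t
    factor t (yes refl) _        = trans (incident-self clone v) (sym (trans (incident-other G v≢s) sv≡1))
    factor t (no t≢v)   (yes refl) =
      trans (incident-other clone t≢v) (trans (clone-edge t≢v) (sym (incident-self G s)))
    factor t (no t≢v)   (no t≢s) =
      trans (incident-other clone t≢v) (trans (clone-twin t≢v t≢s) (sym (incident-other G t≢s)))

  vertexProduct-clone-source : v ≢ s → w G s v ≡ 1 → vertexProduct clone s ≡ vertexProduct G s
  vertexProduct-clone-source v≢s sv≡1 = ∏-cong (λ t → factor t (t ≟ v) (t ≟ s))
    where
    factor : ∀ t → Dec (t ≡ v) → Dec (t ≡ s) → incident clone s t ≡ incident G s t
    factor t (yes refl) _ = begin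
      incident clone s v  ≡⟨ incident-other clone v≢s ⟩
      w clone s v         ≡⟨ Multigraph.sym clone s v ⟩
      w clone v s         ≡⟨ clone-edge (v≢s ∘ sym) ⟩
      1                   ≡⟨ sv≡1 ⟨
      w G s v             ≡⟨ incident-other G v≢s ⟨
      incident G s v      ∎
      where open ≡-Reasoning
    factor t (no _)     (yes refl) = trans (incident-self clone s) (sym (incident-self G s))
    factor t (no t≢v)   (no t≢s)   = begin
      incident clone s t  ≡⟨ incident-other clone t≢s ⟩
      w clone s t         ≡⟨ clone-agreeOff s t (t≢s ∘ sym) (v≢s ∘ sym) t≢v ⟨
      w G s t             ≡⟨ incident-other G t≢s ⟨
      incident G s t      ∎
      where open ≡-Reasoning

  vertexProduct-clone-other : ∀ {x} → x ≢ v → x ≢ s →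
    vertexProduct clone x * w G x v ≡ vertexProduct G x * w G x s
  vertexProduct-clone-other {x} x≢v x≢s = begin
    vertexProduct clone x * w G x v          ≡⟨ cong (vertexProduct clone x *_) (incident-other G (x≢v ∘ sym)) ⟨
    ∏ (incident clone x) * incident G x v    ≡⟨ ∏-except _ _ v agree ⟩
    ∏ (incident G x) * incident clone x v    ≡⟨ cong (vertexProduct G x *_) at-v ⟩
    vertexProduct G x * w G x s              ∎
    where
    open ≡-Reasoning
    agree : ∀ t → t ≢ v → incident clone x t ≡ incident G x t
    agree t t≢v = by-cases (t ≟ x)
      where
      by-cases : Dec (t ≡ x) → incident clone x t ≡ incident G x t
      by-cases (yes refl) = trans (incident-self clone x) (sym (incident-self G x))
      by-cases (no t≢x)   = trans (incident-other clone t≢x)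
        (trans (sym (clone-agreeOff x t (t≢x ∘ sym) x≢v t≢v)) (sym (incident-other G t≢x)))
    at-v : incident clone x v ≡ w G x s
    at-v = trans (incident-other clone (x≢v ∘ sym))
             (trans (Multigraph.sym clone x v) (trans (clone-twin x≢v x≢s) (Multigraph.sym G s x)))

  P-clone : v ≢ s → w G s v ≡ 1 → P clone * vertexProduct G v ≡ P G * vertexProduct G s
  P-clone v≢s sv≡1 =
    trans (P-local G clone v clone-agreeOff) (cong (P G *_) (vertexProduct-clone-self v≢s sv≡1))

-- Maximizers of P over D(n)

complete : Multigraph n
complete = record { w = λ _ _ → 1 ; sym = λ _ _ → refl }

complete-InD : InD (complete {n})
complete-InD =
  (λ _ _ _ _ _ _ _ _ _ _ → m≤m+n 6 9) , (λ _ _ _ → m≤m+n 1 2) , (λ _ _ _ _ _ _ → m≤m+n 3 5)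

P-complete : P (complete {n}) ≡ 1
P-complete {n} = trans (P≡∏row (complete {n})) (trans (∏-cong {n} row≡1) (∏-replicate-1 n))
  where
  row≡1 : ∀ i → row (complete {n}) i ≡ 1
  row≡1 i = trans (∏-cong {n} (λ j → if-eta (does (i <? j)) {1})) (∏-replicate-1 n)

isolate : Multigraph n → Fin n → Multigraph n
isolate G z = record
  { w   = λ i j → if does (i ≟ z) ∨ does (j ≟ z) then 1 else w G i j
  ; sym = λ i j → trans (if-cong (∨-comm (does (i ≟ z)) _))
                        (if-cong-else (does (j ≟ z) ∨ does (i ≟ z)) (Multigraph.sym G i j))
  }

isolate-agreeOff : (G : Multigraph n) (z : Fin n) → AgreeOff z G (isolate G z)
isolate-agreeOff G z i j _ i≢z j≢z =
  sym (if-cong (cong₂ _∨_ (dec-false (i ≟ z) i≢z) (dec-false (j ≟ z) j≢z)))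

vertexProduct-isolate : (G : Multigraph n) (z : Fin n) → vertexProduct (isolate G z) z ≡ 1
vertexProduct-isolate {n} G z = trans (∏-cong {n} factor) (∏-replicate-1 n)
  where
  factor : ∀ t → incident (isolate G z) z t ≡ 1
  factor t = trans (if-cong-else (does (t ≟ z)) (if-cong (cong (_∨ does (t ≟ z)) (dec-true (z ≟ z) refl))))
             (if-eta (does (t ≟ z)) {1})

maximizer-P≢0 : (G : Multigraph n) → MaximizesP G → NonZero (P G)
maximizer-P≢0 {n} G (_ , maximal) =
  >-nonZero (subst (_≤ P G) (P-complete {n}) (maximal complete complete-InD))

maximizer-vertexProduct≢0 : (G : Multigraph n) → MaximizesP G → (z : Fin n) → NonZero (vertexProduct G z)
maximizer-vertexProduct≢0 G max z =
  m*n≢0⇒n≢0 (P (isolate G z)) {{subst NonZero (sym isolated) (maximizer-P≢0 G max)}}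
  where
  isolated : P (isolate G z) * vertexProduct G z ≡ P G
  isolated = trans (P-local G (isolate G z) z (isolate-agreeOff G z))
                   (trans (cong (P G *_) (vertexProduct-isolate G z)) (*-identityʳ (P G)))

maximizer-vertexProduct-≤ : (G : Multigraph n) {v s : Fin n} → MaximizesP G → v ≢ s → w G s v ≡ 1 →
  vertexProduct G s ≤ vertexProduct G v
maximizer-vertexProduct-≤ G {v} {s} max@(inD , maximal) v≢s sv≡1 =
  *-cancelˡ-≤ (P G) {{maximizer-P≢0 G max}} (begin
    P G * vertexProduct G s              ≡⟨ P-clone G v s v≢s sv≡1 ⟨
    P (clone G v s) * vertexProduct G v  ≤⟨ *-monoˡ-≤ (vertexProduct G v) (maximal (clone G v s) (clone-InD G v s inD)) ⟩
    P G * vertexProduct G v              ∎)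
  where open ≤-Reasoning

maximizer-clone-twice-≤ : (G : Multigraph n) {x y z : Fin n} → MaximizesP G →
  x ≢ y → x ≢ z → y ≢ z → w G y z ≡ 1 → w G x z ≡ 1 →
  vertexProduct G z * vertexProduct G z ≤ vertexProduct (clone G y z) x * vertexProduct G y
maximizer-clone-twice-≤ G {x} {y} {z} max@(inD , maximal) x≢y x≢z y≢z yz≡1 xz≡1 =
  *-cancelˡ-≤ (P G) {{maximizer-P≢0 G max}} (begin
    P G * (Z * Z)                   ≡⟨ *-assoc (P G) Z Z ⟨
    P G * Z * Z                     ≡⟨ cong (_* Z) (P-clone G y z y≢z zy≡1) ⟨
    P G₂ * Y * Z                    ≡⟨ xy∙z≈xz∙y (P G₂) Y Z ⟩
    P G₂ * Z * Y                    ≡⟨ cong (λ k → P G₂ * k * Y) (vertexProduct-clone-source G y z y≢z zy≡1) ⟨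
    P G₂ * vertexProduct G₂ z * Y   ≡⟨ cong (_* Y) (P-clone G₂ x z x≢z zx≡1) ⟨
    P G₃ * X₂ * Y                   ≤⟨ *-monoˡ-≤ Y (*-monoˡ-≤ X₂ (maximal G₃ G₃∈D)) ⟩
    P G * X₂ * Y                    ≡⟨ *-assoc (P G) X₂ Y ⟩
    P G * (X₂ * Y)                  ∎)
  where
  open ≤-Reasoning
  G₂ G₃ : Multigraph _
  G₂ = clone G y z
  G₃ = clone G₂ x z
  G₃∈D : InD G₃
  G₃∈D = clone-InD G₂ x z (clone-InD G y z inD)
  Y Z X₂ : ℕ
  Y  = vertexProduct G y
  Z  = vertexProduct G z
  X₂ = vertexProduct G₂ x
  zy≡1 : w G z y ≡ 1
  zy≡1 = trans (Multigraph.sym G z y) yz≡1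
  zx≡1 : w G₂ z x ≡ 1
  zx≡1 = trans (sym (clone-agreeOff G y z z x (x≢z ∘ sym) (y≢z ∘ sym) x≢y)) (trans (Multigraph.sym G z x) xz≡1)

no-heavy-triangle : (G : Multigraph n) {a : ℕ} → MaximizesP G → 2 ≤ a → ¬ HasTriangle a 1 1 G
no-heavy-triangle G {a} max 2≤a (x , y , z , x≢y , x≢z , y≢z , xy≡a , yz≡1 , xz≡1) =
  <⇒≱ (m<m*n (Z * Z) a {{m*n≢0 Z Z}} 2≤a) (begin
    Z * Z * a   ≤⟨ *-monoˡ-≤ a (maximizer-clone-twice-≤ G max x≢y x≢z y≢z yz≡1 xz≡1) ⟩
    X₂ * Y * a  ≡⟨ xy∙z≈xz∙y X₂ Y a ⟩
    X₂ * a * Y  ≡⟨ cong (_* Y) X₂a≡X ⟩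
    X * Y       ≤⟨ *-mono-≤ X≤Z Y≤Z ⟩
    Z * Z       ∎)
  where
  open ≤-Reasoning
  X Y Z X₂ : ℕ
  X  = vertexProduct G x
  Y  = vertexProduct G y
  Z  = vertexProduct G z
  X₂ = vertexProduct (clone G y z) x
  instance
    Z≢0 : NonZero Z
    Z≢0 = maximizer-vertexProduct≢0 G max z
  X≤Z : X ≤ Z
  X≤Z = maximizer-vertexProduct-≤ G max (x≢z ∘ sym) xz≡1
  Y≤Z : Y ≤ Z
  Y≤Z = maximizer-vertexProduct-≤ G max (y≢z ∘ sym) yz≡1
  X₂a≡X : X₂ * a ≡ X
  X₂a≡X = begin-equality
    X₂ * a          ≡⟨ cong (X₂ *_) xy≡a ⟨
    X₂ * w G x y    ≡⟨ vertexProduct-clone-other G y z x≢y x≢z ⟩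
    X * w G x z     ≡⟨ cong (X *_) xz≡1 ⟩
    X * 1           ≡⟨ *-identityʳ X ⟩
    X               ∎

lemma5p3 : (n : ℕ) → n ≥ 1 → (G : Multigraph n) → MaximizesP G →
    ¬ HasTriangle 3 1 1 G × ¬ HasTriangle 2 1 1 G
lemma5p3 n _ G max = no-heavy-triangle G max (s≤s (s≤s z≤n)) , no-heavy-triangle G max (s≤s (s≤s z≤n))
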